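{- Let $D(x)=1-58x-522x^2+729x^3$. Define integer sequences $(a_n),(b_n),(c_n)$ by the power series expansions about $x=0$ and rational sequences $(\alpha_n),(\beta_n),(\gamma_n)$ by the expansions about $x=\infty$ (in powers of $1/x$): \[ \frac{2-8x-90x^2}{D(x)}=\sum_{n\ge0}a_nx^n=\sum_{n\ge1}\alpha_{n-1}x^{ -n}, \] \[ \frac{1+53x+9x^2}{D(x)}=\sum_{n\ge0}b_nx^n=\sum_{n\ge1}\beta_{n-1}x^{ -n}, \] \[ \frac{2+22x-108x^2}{D(x)}=\sum_{n\ge0}c_nx^n=\sum_{n\ge1}\gamma_{n-1}x^{ -n}. \] Then for all $n\ge0$, \[ a_n^3+b_n^3=c_n^3+\big((-9)^n\big)^3\quad\text{and}\quad \alpha_n^3+\beta_n^3=\gamma_n^3-\delta_n^3,\ \text{ where } \delta_n=(-1/9)^{n+1}. \] -}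

module Defs where

open import Data.Nat using (ℕ; zero; suc)
open import Data.Integer using (ℤ; +_; -[1+_])
open import Data.Rational using (ℚ; 0ℚ; 1ℚ; _+_; _-_; _*_; -_; _/_; 1/_; NonZero)
open import Data.List using (List; []; _∷_; zipWith; reverse; foldr; drop)

-- A polynomial is the list of its coefficients, constant term first:
-- [ p₀ , p₁ , … , p_d ]  represents  p₀ + p₁ x + … + p_d x^d.
Poly : Set
Poly = List ℚ

coeff : Poly → ℕ → ℚ
coeff []       _       = 0ℚ
coeff (a ∷ _)  zero    = a
coeff (_ ∷ as) (suc n) = coeff as n

sumℚ : List ℚ → ℚ
sumℚ = foldr _+_ 0ℚ

-- Formal power series expansion about x = 0 of  p(x) / q(x),
-- where q(0) = q₀ ≠ 0.  It is the unique series c with q · c = p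
-- (Cauchy product), i.e.  c_n = (p_n - Σ_{k=1}^{n} q_k c_{n-k}) / q₀.
module _ (p q : Poly) .{{_ : NonZero (coeff q 0)}} where

  private
    qs : Poly
    qs = drop 1 q

    next : ℕ → List ℚ → ℚ
    next n prev = (coeff p n - sumℚ (zipWith _*_ qs prev)) * (1/ coeff q 0)

    -- [ c_{n-1} , … , c_0 ]
    build : ℕ → List ℚ
    build zero    = []
    build (suc n) = next n (build n) ∷ build n

  seriesAt0 : ℕ → ℚ
  seriesAt0 n = next n (build n)

padTo : ℕ → Poly → Poly
padTo zero    _        = []
padTo (suc k) []       = 0ℚ ∷ padTo k []
padTo (suc k) (a ∷ as) = a ∷ padTo k as

-- padRev d p represents  y^d · p(1/y)   (for deg p ≤ d).
padRev : ℕ → Poly → Poly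
padRev d p = reverse (padTo (suc d) p)

-- Expansion about x = ∞ of  p(x) / q(x), where deg q = d and deg p < d:
-- with y = 1/x,  p(x)/q(x) = (y^d p(1/y)) / (y^d q(1/y)) = Σ_{m≥0} e_m y^m
-- with e_0 = 0 (as deg p < d).  Writing it as Σ_{n≥1} ω_{n-1} x^{-n}
-- gives ω_n = e_{n+1}.  The instance says the leading coefficient
-- of q (the x^d coefficient) is nonzero.
seriesAtInf : (d : ℕ) (p q : Poly) .{{_ : NonZero (coeff (padRev d q) 0)}} → ℕ → ℚ
seriesAtInf d p q n = seriesAt0 (padRev d p) (padRev d q) (suc n)

infixr 8 _^_
_^_ : ℚ → ℕ → ℚ
x ^ zero  = 1ℚ
x ^ suc n = x * (x ^ n)

ι : ℤ → ℚ
ι z = z / 1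

Dpoly : Poly
Dpoly = ι (+ 1) ∷ ι -[1+ 57 ] ∷ ι -[1+ 521 ] ∷ ι (+ 729) ∷ []

Apoly : Poly
Apoly = ι (+ 2) ∷ ι -[1+ 7 ] ∷ ι -[1+ 89 ] ∷ []

Bpoly : Poly
Bpoly = ι (+ 1) ∷ ι (+ 53) ∷ ι (+ 9) ∷ []

Cpoly : Poly
Cpoly = ι (+ 2) ∷ ι (+ 22) ∷ ι -[1+ 107 ] ∷ []

a b c : ℕ → ℚ
a = seriesAt0 Apoly Dpoly
b = seriesAt0 Bpoly Dpoly
c = seriesAt0 Cpoly Dpoly

α β γ : ℕ → ℚ
α = seriesAtInf 3 Apoly Dpoly
β = seriesAtInf 3 Bpoly Dpoly
γ = seriesAtInf 3 Cpoly Dpoly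

δ : ℕ → ℚ
δ n = (- (+ 1 / 9)) ^ suc n

-- The expansions a, b, c at 0 and the sequence (−9)ⁿ all satisfy the linear recurrence with
-- characteristic polynomial x³ D(1/x) = x³ − 58x² − 522x + 729 = (x + 9)(x² − 67x + 81), whose
-- roots are −9, r, s with rs = 81.  The cube of a solution is a combination of the n-th powers
-- of the ten products of three roots, and since rs = 81 these take only seven values.  Hence the
-- four cubes, and with them a³ + b³ − c³ − (−9)³ⁿ, satisfy a single monic recurrence of order
-- seven, so this difference vanishes as soon as it vanishes for n < 7.  The expansions at ∞
-- and δ satisfy the same recurrence read backwards (characteristic polynomial D, with the
-- reciprocal roots), and the reversed order-seven recurrence, whose leading coefficient is the
-- nonzero constant term of the first, settles the second identity in the same way.
module Submission where

open import Defs
open import Data.Nat as ℕ using (ℕ; zero; suc; _<_; _<?_; _∸_; z<s; s<s)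
open import Data.Nat.Properties using (suc-injective; +-suc; ≮⇒≥; m+[n∸m]≡n; +-monoˡ-<)
open import Data.Nat.Induction using (<-rec)
open import Data.Integer using (+_; -[1+_])
open import Data.Rational using (ℚ; 0ℚ; 1ℚ; _+_; _-_; -_; _*_; _/_; 1/_; NonZero)
open import Data.Rational.Properties
  using (+-assoc; +-comm; +-identityˡ; +-identityʳ; *-assoc; *-identityˡ; *-identityʳ; *-zeroʳ; *-inverseˡ; *-inverseʳ; +-0-group)
open import Data.Rational.Solver using (module +-*-Solver)
open import Data.List using (List; []; _∷_; _∷ʳ_; reverse; length; map; take; upTo)
open import Data.List.Properties using (unfold-reverse; length-reverse)
open import Data.List.Relation.Unary.All using (All; _∷_; [])
open import Data.List.Relation.Unary.All.Properties using (applyUpTo⁻)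
open import Data.Product using (_×_; _,_)
open import Function using (id)
open import Relation.Nullary using (yes; no)
open import Relation.Binary.PropositionalEquality
  using (_≡_; refl; sym; trans; cong; cong₂; subst; module ≡-Reasoning)
open import Algebra.Properties.Group +-0-group using (inverseʳ-unique; x∙y⁻¹≈ε⇒x≈y)

open ≡-Reasoning
open +-*-Solver using (solve; _:=_; con; _:+_; _:*_; :-_)

infix 8 _·_

_·_ : List ℚ → List ℚ → ℚ
(p ∷ ps) · (x ∷ xs) = p * x + ps · xs
_        · _        = 0ℚ

window : ℕ → (ℕ → ℚ) → ℕ → List ℚ
window zero    u n = []
window (suc k) u n = u n ∷ window k u (suc n)

record Annihilates (p : Poly) (u : ℕ → ℚ) : Set where
  constructor annihilates
  field recurrence : ∀ n → p · window (length p) u n ≡ 0ℚ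

p*q≡0⇒q≡0 : ∀ p .{{_ : NonZero p}} q → p * q ≡ 0ℚ → q ≡ 0ℚ
p*q≡0⇒q≡0 p q pq≡0 = begin
  q                ≡⟨ sym (*-identityˡ q) ⟩
  1ℚ * q           ≡⟨ cong (_* q) (sym (*-inverseˡ p)) ⟩
  (1/ p * p) * q   ≡⟨ *-assoc (1/ p) p q ⟩
  1/ p * (p * q)   ≡⟨ cong (1/ p *_) pq≡0 ⟩
  1/ p * 0ℚ        ≡⟨ *-zeroʳ (1/ p) ⟩
  0ℚ               ∎

·-∷ʳ : ∀ ps p xs x → length ps ≡ length xs → (ps ∷ʳ p) · (xs ∷ʳ x) ≡ ps · xs + p * x
·-∷ʳ []       p []       x _  = +-comm (p * x) 0ℚ
·-∷ʳ (q ∷ ps) p (y ∷ xs) x eq = begin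
  q * y + (ps ∷ʳ p) · (xs ∷ʳ x)  ≡⟨ cong (λ t → q * y + t) (·-∷ʳ ps p xs x (suc-injective eq)) ⟩
  q * y + (ps · xs + p * x)      ≡⟨ sym (+-assoc (q * y) (ps · xs) (p * x)) ⟩
  q * y + ps · xs + p * x        ∎

·-reverse : ∀ ps xs → length ps ≡ length xs → reverse ps · reverse xs ≡ ps · xs
·-reverse []       []       _  = refl
·-reverse (p ∷ ps) (x ∷ xs) eq = begin
  reverse (p ∷ ps) · reverse (x ∷ xs)    ≡⟨ cong₂ _·_ (unfold-reverse p ps) (unfold-reverse x xs) ⟩
  (reverse ps ∷ʳ p) · (reverse xs ∷ʳ x)  ≡⟨ ·-∷ʳ (reverse ps) p (reverse xs) x lengths ⟩
  reverse ps · reverse xs + p * x        ≡⟨ cong (_+ p * x) (·-reverse ps xs (suc-injective eq)) ⟩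
  ps · xs + p * x                        ≡⟨ +-comm (ps · xs) (p * x) ⟩
  p * x + ps · xs                        ∎
  where
  lengths : length (reverse ps) ≡ length (reverse xs)
  lengths = trans (length-reverse ps) (trans (suc-injective eq) (sym (length-reverse xs)))

monic-step : ∀ ps xs x → length ps ≡ length xs → (ps ∷ʳ 1ℚ) · (xs ∷ʳ x) ≡ 0ℚ → x ≡ - (ps · xs)
monic-step ps xs x eq h = inverseʳ-unique (ps · xs) x (begin
  ps · xs + x               ≡⟨ cong (λ t → ps · xs + t) (sym (*-identityˡ x)) ⟩
  ps · xs + 1ℚ * x          ≡⟨ sym (·-∷ʳ ps 1ℚ xs x eq) ⟩
  (ps ∷ʳ 1ℚ) · (xs ∷ʳ x)    ≡⟨ h ⟩
  0ℚ                        ∎)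

module _ {u v : ℕ → ℚ} where

  ·-window-+ : ∀ ps k n → ps · window k (λ m → u m + v m) n ≡ ps · window k u n + ps · window k v n
  ·-window-+ []       k       n = refl
  ·-window-+ (p ∷ ps) zero    n = refl
  ·-window-+ (p ∷ ps) (suc k) n = begin
    p * (u n + v n) + ps · window k (λ m → u m + v m) (suc n)
      ≡⟨ cong (λ t → p * (u n + v n) + t) (·-window-+ ps k (suc n)) ⟩
    p * (u n + v n) + (U + V)
      ≡⟨ solve 5 (λ p x y s t → p :* (x :+ y) :+ (s :+ t) := p :* x :+ s :+ (p :* y :+ t)) refl p (u n) (v n) U V ⟩
    p * u n + U + (p * v n + V)
      ∎
    where
    U V : ℚ
    U = ps · window k u (suc n)
    V = ps · window k v (suc n)

module _ {u : ℕ → ℚ} where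

  ·-window-neg : ∀ ps k n → ps · window k (λ m → - u m) n ≡ - (ps · window k u n)
  ·-window-neg []       k       n = refl
  ·-window-neg (p ∷ ps) zero    n = refl
  ·-window-neg (p ∷ ps) (suc k) n = begin
    p * (- u n) + ps · window k (λ m → - u m) (suc n)
      ≡⟨ cong (λ t → p * (- u n) + t) (·-window-neg ps k (suc n)) ⟩
    p * (- u n) + - U
      ≡⟨ solve 3 (λ p x s → p :* (:- x) :+ :- s := :- (p :* x :+ s)) refl p (u n) U ⟩
    - (p * u n + U)
      ∎
    where
    U : ℚ
    U = ps · window k u (suc n)

  ·-window-* : ∀ x ps k n → ps · window k (λ m → x * u m) n ≡ x * (ps · window k u n)
  ·-window-* x []       k       n = sym (*-zeroʳ x)
  ·-window-* x (p ∷ ps) zero    n = sym (*-zeroʳ x)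
  ·-window-* x (p ∷ ps) (suc k) n = begin
    p * (x * u n) + ps · window k (λ m → x * u m) (suc n)
      ≡⟨ cong (λ t → p * (x * u n) + t) (·-window-* x ps k (suc n)) ⟩
    p * (x * u n) + x * U
      ≡⟨ solve 4 (λ x p y s → p :* (x :* y) :+ x :* s := x :* (p :* y :+ s)) refl x p (u n) U ⟩
    x * (p * u n + U)
      ∎
    where
    U : ℚ
    U = ps · window k u (suc n)

annihilates-+ : ∀ {p u v} → Annihilates p u → Annihilates p v → Annihilates p (λ n → u n + v n)
annihilates-+ {p} (annihilates hu) (annihilates hv) = annihilates λ n →
  trans (·-window-+ p (length p) n) (cong₂ _+_ (hu n) (hv n))

annihilates-neg : ∀ {p u} → Annihilates p u → Annihilates p (λ n → - u n)
annihilates-neg {p} (annihilates hu) = annihilates λ n →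
  trans (·-window-neg p (length p) n) (cong -_ (hu n))

annihilates-- : ∀ {p u v} → Annihilates p u → Annihilates p v → Annihilates p (λ n → u n - v n)
annihilates-- hu hv = annihilates-+ hu (annihilates-neg hv)

annihilates-* : ∀ {p u} x → Annihilates p u → Annihilates p (λ n → x * u n)
annihilates-* {p} x (annihilates hu) = annihilates λ n →
  trans (·-window-* x p (length p) n) (trans (cong (x *_) (hu n)) (*-zeroʳ x))

module _ {w : ℕ → ℚ} where

  ·-window-last : ∀ p k n → length p ≡ suc k →
                  p · window (length p) w n ≡ take k p · window k w n + coeff p k * w (k ℕ.+ n)
  ·-window-last []          k       n ()
  ·-window-last (c ∷ [])    zero    n refl = +-comm (c * w n) 0ℚ
  ·-window-last (c ∷ _ ∷ _) zero    n ()
  ·-window-last (c ∷ ps)    (suc k) n eq = begin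
    c * w n + ps · window (length ps) w (suc n)
      ≡⟨ cong (λ t → c * w n + t) (·-window-last ps k (suc n) (suc-injective eq)) ⟩
    c * w n + (T + coeff ps k * w (k ℕ.+ suc n))
      ≡⟨ cong (λ i → c * w n + (T + coeff ps k * w i)) (+-suc k n) ⟩
    c * w n + (T + coeff ps k * w (suc k ℕ.+ n))
      ≡⟨ sym (+-assoc (c * w n) T _) ⟩
    c * w n + T + coeff ps k * w (suc k ℕ.+ n)
      ∎
    where
    T : ℚ
    T = take k ps · window k w (suc n)

  ·-window-zeros : ∀ ps k n → (∀ i → i < k → w (i ℕ.+ n) ≡ 0ℚ) → ps · window k w n ≡ 0ℚ
  ·-window-zeros []       k       n zeros = refl
  ·-window-zeros (p ∷ ps) zero    n zeros = refl
  ·-window-zeros (p ∷ ps) (suc k) n zeros = begin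
    p * w n + ps · window k w (suc n)
      ≡⟨ cong₂ (λ x t → p * x + t) (zeros 0 z<s) (·-window-zeros ps k (suc n) zeros′) ⟩
    p * 0ℚ + 0ℚ
      ≡⟨ trans (+-identityʳ (p * 0ℚ)) (*-zeroʳ p) ⟩
    0ℚ
      ∎
    where
    zeros′ : ∀ i → i < k → w (i ℕ.+ suc n) ≡ 0ℚ
    zeros′ i i<k = trans (cong w (+-suc i n)) (zeros (suc i) (s<s i<k))

  module _ (p : Poly) (k : ℕ) .{{_ : NonZero (coeff p k)}} (deg : length p ≡ suc k)
           (ann : Annihilates p w) where

    next-term-zero : ∀ n → (∀ i → i < k → w (i ℕ.+ n) ≡ 0ℚ) → w (k ℕ.+ n) ≡ 0ℚ
    next-term-zero n zeros = p*q≡0⇒q≡0 (coeff p k) (w (k ℕ.+ n)) (begin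
      coeff p k * w (k ℕ.+ n)
        ≡⟨ sym (+-identityˡ _) ⟩
      0ℚ + coeff p k * w (k ℕ.+ n)
        ≡⟨ cong (_+ coeff p k * w (k ℕ.+ n)) (sym (·-window-zeros (take k p) k n zeros)) ⟩
      take k p · window k w n + coeff p k * w (k ℕ.+ n)
        ≡⟨ sym (·-window-last p k n deg) ⟩
      p · window (length p) w n
        ≡⟨ Annihilates.recurrence ann n ⟩
      0ℚ
        ∎)

    annihilated-vanishes : All (λ i → w i ≡ 0ℚ) (upTo k) → ∀ n → w n ≡ 0ℚ
    annihilated-vanishes initial = <-rec (λ n → w n ≡ 0ℚ) vanish
      where
      vanish : ∀ n → (∀ {j} → j < n → w j ≡ 0ℚ) → w n ≡ 0ℚ
      vanish n earlier with n <? k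
      ... | yes n<k = applyUpTo⁻ id k initial n<k
      ... | no  n≮k = subst (λ j → w j ≡ 0ℚ) k+m≡n (next-term-zero m (λ i i<k → earlier (before i i<k)))
        where
        m = n ∸ k
        k+m≡n : k ℕ.+ m ≡ n
        k+m≡n = m+[n∸m]≡n (≮⇒≥ n≮k)
        before : ∀ i → i < k → i ℕ.+ m < n
        before i i<k = subst (i ℕ.+ m <_) k+m≡n (+-monoˡ-< m i<k)

eval : Poly → ℚ → ℚ
eval []       r = 0ℚ
eval (c ∷ cs) r = c + r * eval cs r

·-window-geometric : ∀ r p n → p · window (length p) (r ^_) n ≡ r ^ n * eval p r
·-window-geometric r []       n = sym (*-zeroʳ (r ^ n))
·-window-geometric r (c ∷ cs) n = begin
  c * r ^ n + cs · window (length cs) (r ^_) (suc n)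
    ≡⟨ cong (λ t → c * r ^ n + t) (·-window-geometric r cs (suc n)) ⟩
  c * r ^ n + r * r ^ n * eval cs r
    ≡⟨ solve 4 (λ c r x e → c :* x :+ r :* x :* e := x :* (c :+ r :* e)) refl c r (r ^ n) (eval cs r) ⟩
  r ^ n * (c + r * eval cs r)
    ∎

geometric-annihilated : ∀ {p r} → eval p r ≡ 0ℚ → Annihilates p (r ^_)
geometric-annihilated {p} {r} root = annihilates λ n → begin
  p · window (length p) (r ^_) n ≡⟨ ·-window-geometric r p n ⟩
  r ^ n * eval p r               ≡⟨ cong (r ^ n *_) root ⟩
  r ^ n * 0ℚ                     ≡⟨ *-zeroʳ (r ^ n) ⟩
  0ℚ                             ∎

seriesAt0-annihilated : ∀ p q .{{_ : NonZero (coeff q 0)}} → length q ≡ 4 →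
  ∀ m → coeff p (3 ℕ.+ m) ≡ 0ℚ → reverse q · window 4 (seriesAt0 p q) m ≡ 0ℚ
seriesAt0-annihilated p (q₀ ∷ q₁ ∷ q₂ ∷ q₃ ∷ []) refl m p₃₊ₘ≡0 = begin
  q₃ * e₀ + (q₂ * e₁ + (q₁ * e₂ + (q₀ * e₃ + 0ℚ)))
    ≡⟨ cong (λ t → q₃ * e₀ + (q₂ * e₁ + (q₁ * e₂ + (t + 0ℚ)))) leading ⟩
  q₃ * e₀ + (q₂ * e₁ + (q₁ * e₂ + (- s + 0ℚ)))
    ≡⟨ solve 3 (λ x y z → x :+ (y :+ (z :+ (:- (z :+ (y :+ (x :+ con 0ℚ))) :+ con 0ℚ))) := con 0ℚ) refl
         (q₃ * e₀) (q₂ * e₁) (q₁ * e₂) ⟩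
  0ℚ
    ∎
  where
  e : ℕ → ℚ
  e = seriesAt0 p (q₀ ∷ q₁ ∷ q₂ ∷ q₃ ∷ [])
  e₀ e₁ e₂ e₃ s : ℚ
  e₀ = e m
  e₁ = e (1 ℕ.+ m)
  e₂ = e (2 ℕ.+ m)
  e₃ = e (3 ℕ.+ m)
  s = q₁ * e₂ + (q₂ * e₁ + (q₃ * e₀ + 0ℚ))
  leading : q₀ * e₃ ≡ - s
  leading = begin
    q₀ * e₃                                ≡⟨⟩
    q₀ * ((coeff p (3 ℕ.+ m) - s) * 1/ q₀) ≡⟨ cong (λ c → q₀ * ((c - s) * 1/ q₀)) p₃₊ₘ≡0 ⟩
    q₀ * ((0ℚ - s) * 1/ q₀)                ≡⟨ solve 3 (λ q s i → q :* ((con 0ℚ :+ :- s) :* i) := :- s :* (q :* i))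
                                                  refl q₀ s (1/ q₀) ⟩
    - s * (q₀ * 1/ q₀)                     ≡⟨ cong (- s *_) (*-inverseʳ q₀) ⟩
    - s * 1ℚ                               ≡⟨ *-identityʳ (- s) ⟩
    - s                                    ∎

reciprocalD : Poly
reciprocalD = reverse Dpoly

seriesAt0-Dpoly-annihilated : ∀ p → (∀ m → coeff p (3 ℕ.+ m) ≡ 0ℚ) →
                              Annihilates reciprocalD (seriesAt0 p Dpoly)
seriesAt0-Dpoly-annihilated p high = annihilates λ m →
  seriesAt0-annihilated p Dpoly refl m (high m)

seriesAtInf-Dpoly-annihilated : ∀ p → (∀ m → coeff (padRev 3 p) (4 ℕ.+ m) ≡ 0ℚ) →
                                Annihilates Dpoly (seriesAtInf 3 p Dpoly)
seriesAtInf-Dpoly-annihilated p high = annihilates λ m →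
  seriesAt0-annihilated (padRev 3 p) (padRev 3 Dpoly) refl (suc m) (high m)

nextTerm : ℚ → ℚ → ℚ → ℚ
nextTerm x₀ x₁ x₂ = - (reciprocalD · (x₀ ∷ x₁ ∷ x₂ ∷ []))

solution-step : ∀ v₀ v₁ v₂ v₃ → reciprocalD · (v₀ ∷ v₁ ∷ v₂ ∷ v₃ ∷ []) ≡ 0ℚ → v₃ ≡ nextTerm v₀ v₁ v₂
solution-step v₀ v₁ v₂ v₃ = monic-step (take 3 reciprocalD) (v₀ ∷ v₁ ∷ v₂ ∷ []) v₃ refl

-- (x + 729)(x − r³)(x − s³)(x − 81r)(x − 81s)(x + 9r²)(x + 9s²) expanded, where −9, r, s are the
-- roots of reciprocalD.
cubeAnnihilator : Poly
cubeAnnihilator =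
  ι (+ 109418989131512359209) ∷ ι -[1+ 51521579221968681812 ] ∷ ι -[1+ 3846079039618587095 ] ∷
  ι (+ 38456949754686060) ∷ ι (+ 52753017496140) ∷ ι -[1+ 9927402263 ] ∷ ι -[1+ 250236 ] ∷ ι (+ 1) ∷ []

cubes-annihilated : ∀ v₀ v₁ v₂ {v₃ v₄ v₅ v₆ v₇} →
  v₃ ≡ nextTerm v₀ v₁ v₂ → v₄ ≡ nextTerm v₁ v₂ v₃ → v₅ ≡ nextTerm v₂ v₃ v₄ →
  v₆ ≡ nextTerm v₃ v₄ v₅ → v₇ ≡ nextTerm v₄ v₅ v₆ →
  cubeAnnihilator · map (_^ 3) (v₀ ∷ v₁ ∷ v₂ ∷ v₃ ∷ v₄ ∷ v₅ ∷ v₆ ∷ v₇ ∷ []) ≡ 0ℚ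
cubes-annihilated v₀ v₁ v₂ refl refl refl refl refl =
  solve 3 (λ x₀ x₁ x₂ →
    let x₃ = next x₀ x₁ x₂; x₄ = next x₁ x₂ x₃; x₅ = next x₂ x₃ x₄; x₆ = next x₃ x₄ x₅; x₇ = next x₄ x₅ x₆
    in dot cubeAnnihilator (map cube (x₀ ∷ x₁ ∷ x₂ ∷ x₃ ∷ x₄ ∷ x₅ ∷ x₆ ∷ x₇ ∷ [])) := con 0ℚ)
    refl v₀ v₁ v₂
  where
  -- solver syntax for _·_, _^ 3 and nextTerm, so that the solved equation is the goal on the nose
  open +-*-Solver using (Polynomial)
  dot : List ℚ → List (Polynomial 3) → Polynomial 3
  dot (p ∷ ps) (x ∷ xs) = con p :* x :+ dot ps xs
  dot _        _        = con 0ℚ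
  cube : Polynomial 3 → Polynomial 3
  cube x = x :* (x :* (x :* con 1ℚ))
  next : Polynomial 3 → Polynomial 3 → Polynomial 3 → Polynomial 3
  next x₀ x₁ x₂ = :- dot reciprocalD (x₀ ∷ x₁ ∷ x₂ ∷ [])

module _ {u : ℕ → ℚ} where

  cubes-forward : Annihilates reciprocalD u → Annihilates cubeAnnihilator (λ n → u n ^ 3)
  cubes-forward (annihilates ann) = annihilates λ n →
    cubes-annihilated (u n) (u (1 ℕ.+ n)) (u (2 ℕ.+ n))
      (step n) (step (1 ℕ.+ n)) (step (2 ℕ.+ n)) (step (3 ℕ.+ n)) (step (4 ℕ.+ n))
    where
    step : ∀ m → u (3 ℕ.+ m) ≡ nextTerm (u m) (u (1 ℕ.+ m)) (u (2 ℕ.+ m))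
    step m = solution-step (u m) (u (1 ℕ.+ m)) (u (2 ℕ.+ m)) (u (3 ℕ.+ m)) (ann m)

  cubes-backward : Annihilates Dpoly u → Annihilates (reverse cubeAnnihilator) (λ n → u n ^ 3)
  cubes-backward (annihilates ann) = annihilates λ n →
    trans (·-reverse cubeAnnihilator (reverse (window 8 (λ m → u m ^ 3) n)) refl)
      (cubes-annihilated (u (7 ℕ.+ n)) (u (6 ℕ.+ n)) (u (5 ℕ.+ n))
        (step (4 ℕ.+ n)) (step (3 ℕ.+ n)) (step (2 ℕ.+ n)) (step (1 ℕ.+ n)) (step n))
    where
    step : ∀ m → u m ≡ nextTerm (u (3 ℕ.+ m)) (u (2 ℕ.+ m)) (u (1 ℕ.+ m))
    step m = solution-step (u (3 ℕ.+ m)) (u (2 ℕ.+ m)) (u (1 ℕ.+ m)) (u m)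
      (trans (·-reverse Dpoly (window 4 u m) refl) (ann m))

theorem2p4 : (n : ℕ) →
    (a n ^ 3 + b n ^ 3 ≡ c n ^ 3 + ((- ι (+ 9)) ^ n) ^ 3)
      × (α n ^ 3 + β n ^ 3 ≡ γ n ^ 3 - δ n ^ 3)
theorem2p4 n = x∙y⁻¹≈ε⇒x≈y _ _ (defect₀ n) , x∙y⁻¹≈ε⇒x≈y _ _ (defect∞ n)
  where
  defect₀ : ∀ n → a n ^ 3 + b n ^ 3 - (c n ^ 3 + ((- ι (+ 9)) ^ n) ^ 3) ≡ 0ℚ
  defect₀ = annihilated-vanishes cubeAnnihilator 7 refl
    (annihilates--
      (annihilates-+ (cubes-forward (seriesAt0-Dpoly-annihilated Apoly λ _ → refl))
                     (cubes-forward (seriesAt0-Dpoly-annihilated Bpoly λ _ → refl)))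
      (annihilates-+ (cubes-forward (seriesAt0-Dpoly-annihilated Cpoly λ _ → refl))
                     (cubes-forward (geometric-annihilated {reciprocalD} { - ι (+ 9)} refl))))
    (refl ∷ refl ∷ refl ∷ refl ∷ refl ∷ refl ∷ refl ∷ [])

  defect∞ : ∀ n → α n ^ 3 + β n ^ 3 - (γ n ^ 3 - δ n ^ 3) ≡ 0ℚ
  defect∞ = annihilated-vanishes (reverse cubeAnnihilator) 7 refl
    (annihilates--
      (annihilates-+ (cubes-backward (seriesAtInf-Dpoly-annihilated Apoly λ _ → refl))
                     (cubes-backward (seriesAtInf-Dpoly-annihilated Bpoly λ _ → refl)))
      (annihilates-- (cubes-backward (seriesAtInf-Dpoly-annihilated Cpoly λ _ → refl))
                     (cubes-backward (annihilates-* (- (+ 1 / 9)) (geometric-annihilated {Dpoly} refl)))))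
    (refl ∷ refl ∷ refl ∷ refl ∷ refl ∷ refl ∷ refl ∷ [])
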